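{- Let $G=(V,E)$ be a connected chordal claw-free graph with clique tree $T_G=(\mathcal M,\mathcal E)$, let $v,w\in V$, and let $B\in\mathcal M$. If $T_G[\mathcal M_w]$ and $T_G[\mathcal M_v]$ fork in $B$, then $B$ has a fork triangle.
   Context: Graphs are finite simple undirected. A graph is chordal if every cycle of length at least 4 has a chord, and claw-free if it has no induced $K_{1,3}$. A max clique is an inclusion-maximal clique; $\mathcal M$ is the set of max cliques and $\mathcal M_v$ the set of max cliques containing $v$. A clique tree is a tree on $\mathcal M$ in which each $T[\mathcal M_v]$ is connected; a connected chordal claw-free graph has exactly one clique tree $T_G$, and each $T_G[\mathcal M_v]$ is a path. For paths $P,Q$ in $T_G$, a triple $(A',A,\{A_P,A_Q\})$ is a fork of $P$ and $Q$ if $P[\{A',A,A_P\}]$ and $Q[\{A',A,A_Q\}]$ are induced subpaths with three vertices each (with $A$ in the middle), $A_P$ does not occur in $Q$ and $A_Q$ does not occur in $P$; $P$ and $Q$ fork in $A$ if such a fork exists. Max cliques $A_1,A_2,A_3$ form a fork triangle around $B$ if they are distinct neighbours of $B$ in $T_G$ and there are $u,v,w\in V$ with $\mathcal M_u=\{A_1,B,A_2\}$, $\mathcal M_v=\{A_2,B,A_3\}$, $\mathcal M_w=\{A_3,B,A_1\}$; $B$ has a fork triangle if some such $A_1,A_2,A_3$ exist. -}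

module Defs where

open import Data.Nat using (ℕ; suc; _≤_; _<_)
open import Data.Fin using (Fin; toℕ)
open import Data.Fin.Subset using (Subset; _∈_; _∉_; _⊆_)
open import Data.Product using (Σ; ∃; _×_; _,_)
open import Data.Sum using (_⊎_)
open import Relation.Nullary using (¬_)
open import Relation.Binary.PropositionalEquality using (_≡_; _≢_)
open import Function.Definitions using (Injective)

record Graph (n : ℕ) : Set₁ where
  field
    Adj    : Fin n → Fin n → Set
    sym    : ∀ {x y} → Adj x y → Adj y x
    irrefl : ∀ {x} → ¬ Adj x x
open Graph public

data Walk {A : Set} (R : A → A → Set) (P : A → Set) : A → A → Set where
  here : ∀ {x} → P x → Walk R P x x
  step : ∀ {x y z} → P x → R x y → Walk R P y z → Walk R P x z

-- c : Fin m → A is a cycle c₀ c₁ … c_{m-1} c₀ of length m w.r.t. R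
-- (distinct vertices, consecutive ones related, last related to first).
IsCycle : {A : Set} → (A → A → Set) → (m : ℕ) → (Fin m → A) → Set
IsCycle R m c =
  Injective _≡_ _≡_ c
  × (∀ i j → toℕ j ≡ suc (toℕ i) → R (c i) (c j))
  × (∀ i j → toℕ i ≡ 0 → suc (toℕ j) ≡ m → R (c j) (c i))

HasChord : ∀ {n} → Graph n → (m : ℕ) → (Fin m → Fin n) → Set
HasChord G m c = Σ (Fin _) λ i → Σ (Fin _) λ j →
  toℕ i < toℕ j × suc (toℕ i) ≢ toℕ j × ¬ (toℕ i ≡ 0 × suc (toℕ j) ≡ m)
  × Adj G (c i) (c j)

Chordal : ∀ {n} → Graph n → Set
Chordal G = ∀ m → 4 ≤ m → (c : Fin m → Fin _) → IsCycle (Adj G) m c → HasChord G m c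

ClawFree : ∀ {n} → Graph n → Set
ClawFree G = ∀ x a b c → a ≢ b → b ≢ c → a ≢ c →
  Adj G x a → Adj G x b → Adj G x c →
  ¬ (¬ Adj G a b × ¬ Adj G b c × ¬ Adj G a c)

Connected : ∀ {n} → Graph n → Set
Connected G = ∀ x y → Walk (Adj G) (λ _ → ⊤) x y
  where open import Data.Unit using (⊤)

IsClique : ∀ {n} → Graph n → Subset n → Set
IsClique G C = ∀ x y → x ∈ C → y ∈ C → x ≢ y → Adj G x y

MaxClique : ∀ {n} → Graph n → Subset n → Set
MaxClique G C = IsClique G C × (∀ D → IsClique G D → C ⊆ D → D ≡ C)

InM : ∀ {n} → Graph n → Fin n → Subset n → Set
InM G v C = MaxClique G C × v ∈ C

record IsCliqueTree {n : ℕ} (G : Graph n) (T : Subset n → Subset n → Set) : Set where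
  field
    onMax     : ∀ {A B} → T A B → MaxClique G A × MaxClique G B
    symT      : ∀ {A B} → T A B → T B A
    irreflT   : ∀ {A} → ¬ T A A
    connT     : ∀ A B → MaxClique G A → MaxClique G B → Walk T (MaxClique G) A B
    acyclic   : ∀ m → 3 ≤ m → (c : Fin m → Subset n) → ¬ IsCycle T m c
    connMv    : ∀ v A B → InM G v A → InM G v B → Walk T (InM G v) A B

InducedP3 : ∀ {n} → Graph n → (Subset n → Subset n → Set) → Fin n →
            Subset n → Subset n → Subset n → Set
InducedP3 G T w A' A AP =
  InM G w A' × InM G w A × InM G w AP
  × A' ≢ A × A ≢ AP × A' ≢ AP
  × T A' A × T A AP × ¬ T A' AP

ForkIn : ∀ {n} → Graph n → (Subset n → Subset n → Set) → Fin n → Fin n → Subset n → Set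
ForkIn G T w v A = Σ (Subset _) λ A' → Σ (Subset _) λ AP → Σ (Subset _) λ AQ →
  InducedP3 G T w A' A AP × InducedP3 G T v A' A AQ
  × ¬ InM G v AP × ¬ InM G w AQ

MuIs : ∀ {n} → Graph n → Fin n → Subset n → Subset n → Subset n → Set
MuIs G u X B Y = ∀ C → MaxClique G C →
  (u ∈ C → (C ≡ X ⊎ C ≡ B ⊎ C ≡ Y)) × ((C ≡ X ⊎ C ≡ B ⊎ C ≡ Y) → u ∈ C)

HasForkTriangle : ∀ {n} → Graph n → (Subset n → Subset n → Set) → Subset n → Set
HasForkTriangle G T B = Σ (Subset _) λ A₁ → Σ (Subset _) λ A₂ → Σ (Subset _) λ A₃ →
  MaxClique G A₁ × MaxClique G A₂ × MaxClique G A₃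
  × A₁ ≢ A₂ × A₂ ≢ A₃ × A₁ ≢ A₃
  × T B A₁ × T B A₂ × T B A₃
  × (∃ λ u → MuIs G u A₁ B A₂)
  × (∃ λ v → MuIs G v A₂ B A₃)
  × (∃ λ w → MuIs G w A₃ B A₁)

module Submission where

-- Let (A′, B, {A_P, A_Q}) be the fork, so w ∈ A′ ∩ B ∩ A_P ∖ A_Q and
-- v ∈ A′ ∩ B ∩ A_Q ∖ A_P. Pick x ∈ B ∖ A′. Claw-freeness forces x ∈ A_P ∩ A_Q,
-- so each pair of the three neighbours A′, A_P, A_Q of B shares a vertex of B
-- avoiding the third (a "triangle witness"). The main lemma (cliquesOf) shows
-- that such a vertex lies in exactly the three cliques {Y, B, Y′}: a fourth one
-- would be adjacent in T to Y, B or Y′, and each case yields a claw.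
--
-- Every claw is found the same way: two vertices are "apart" when no maximal
-- clique contains both, apart vertices are non-adjacent, and vertices lying in
-- different components of T minus a node (or minus an edge) are apart because
-- T is a tree and T[𝓜_x] is connected.

open import Defs
open import Data.Bool.Properties using () renaming (_≟_ to _≟ᵇ_)
open import Data.Empty using (⊥; ⊥-elim)
open import Data.Fin using (Fin; zero; suc; toℕ) renaming (_≟_ to _≟ᶠ_)
open import Data.Fin.Properties using (any?; all?)
open import Data.Fin.Subset using (Subset; _∈_; _∉_; _⊆_; _∪_; ⁅_⁆)
open import Data.Fin.Subset.Properties
  using (_∈?_; x∈⁅x⁆; x∈⁅y⁆⇒x≡y; p⊆p∪q; x∈p∪q⁻; x∈p∪q⁺; ⊆-antisym)
open import Data.List using (List; []; _∷_; length; lookup; allFin)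
open import Data.List.Membership.Propositional using () renaming (_∈_ to _∈ˡ_)
open import Data.List.Membership.Propositional.Properties using (∈-allFin; ∈-lookup)
open import Data.List.Relation.Unary.All as All using (All; []; _∷_)
open import Data.List.Relation.Unary.All.Properties using (¬Any⇒All¬)
open import Data.List.Relation.Unary.Any using (here; there)
open import Data.List.Relation.Unary.AllPairs using ([]; _∷_)
open import Data.List.Relation.Unary.Unique.Propositional using (Unique)
open import Data.Nat using (zero; suc; s≤s; z≤n)
open import Data.Nat.Properties using (suc-injective)
open import Data.Product using (Σ; ∃; _×_; _,_; proj₁; proj₂)
open import Data.Sum using (_⊎_; inj₁; inj₂)
open import Data.Vec.Properties using (≡-dec)
open import Relation.Binary.Definitions using (DecidableEquality)
open import Relation.Binary.PropositionalEquality as ≡ using (_≡_; _≢_; refl; subst)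
open import Relation.Nullary using (¬_; Dec; yes; no)
open import Relation.Nullary.Decidable
  using (decidable-stable; ¬¬-excluded-middle; ¬?; _×-dec_; _⊎-dec_; _→-dec_)

module Walks {A : Set} (R : A → A → Set) where

  nodes : ∀ {P x y} → Walk R P x y → List A
  later : ∀ {P x y} → Walk R P x y → List A
  nodes {x = x} w = x ∷ later w
  later (here _) = []
  later (step _ _ w) = nodes w

  mapWalk : ∀ {P Q : A → Set} {x y} → (∀ {z} → P z → Q z) → Walk R P x y → Walk R Q x y
  mapWalk f (here p) = here (f p)
  mapWalk f (step p r w) = step (f p) r (mapWalk f w)

  infixr 5 _++ʷ_
  _++ʷ_ : ∀ {P x y z} → Walk R P x y → Walk R P y z → Walk R P x z
  here _ ++ʷ w′ = w′
  step p r w ++ʷ w′ = step p r (w ++ʷ w′)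

  startHolds : ∀ {P x y} → Walk R P x y → P x
  startHolds (here p) = p
  startHolds (step p _ _) = p

  allHold : ∀ {P x y} (w : Walk R P x y) → All P (nodes w)
  allHold (here p) = p ∷ []
  allHold (step p _ w) = p ∷ allHold w

  exitEdge : ∀ {P : A → Set} {x y} (S : A → Set) → (∀ a → Dec (S a)) →
    Walk R P x y → S x → ¬ S y → Σ A λ Y → Σ A λ Z → S Y × ¬ S Z × R Y Z × P Z
  exitEdge S S? (here _) x∈S y∉S = ⊥-elim (y∉S x∈S)
  exitEdge S S? (step {x} {y} _ r w) x∈S z∉S with S? y
  ... | yes y∈S = exitEdge S S? w y∈S z∉S
  ... | no y∉S = x , y , x∈S , y∉S , r , startHolds w

  module _ (_≟_ : DecidableEquality A) where
    open import Data.List.Membership.DecPropositional _≟_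
      using () renaming (_∈?_ to _∈ˡ?_)

    afterLastVisit : ∀ {P : A → Set} {x y} (K : A) → Walk R P x y → y ≢ K →
      Walk R (λ N → P N × N ≢ K) x y
      ⊎ Σ A (λ K′ → R K K′ × P K′ × Walk R (λ N → P N × N ≢ K) K′ y)
    afterLastVisit K (here p) y≢K = inj₁ (here (p , y≢K))
    afterLastVisit K (step {x} {y} p r w) z≢K with afterLastVisit K w z≢K
    ... | inj₂ rest = inj₂ rest
    ... | inj₁ w′ with x ≟ K
    ...   | yes refl = inj₂ (y , r , proj₁ (startHolds w′) , w′)
    ...   | no x≢K = inj₁ (step (p , x≢K) r w′)

    tailFrom : ∀ {P x y} (w : Walk R P x y) {z} → z ∈ˡ nodes w →
      Σ (Walk R P z y) λ w′ → Unique (nodes w) → Unique (nodes w′)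
    tailFrom (here p) (here refl) = here p , λ u → u
    tailFrom (step p r w) (here refl) = step p r w , λ u → u
    tailFrom (step p r w) (there z∈w) with tailFrom w z∈w
    ... | w′ , unique = w′ , λ { (_ ∷ u) → unique u }

    simplify : ∀ {P x y} (w : Walk R P x y) → Σ (Walk R P x y) λ w′ → Unique (nodes w′)
    simplify (here p) = here p , [] ∷ []
    simplify (step {x} p r w) with simplify w
    ... | w′ , unique with x ∈ˡ? nodes w′
    ...   | yes x∈w′ = proj₁ (tailFrom w′ x∈w′) , proj₂ (tailFrom w′ x∈w′) unique
    ...   | no x∉w′ = step p r w′ , ¬Any⇒All¬ _ x∉w′ ∷ unique

  consecutive : ∀ {P x y} (w : Walk R P x y) (i j : Fin (length (nodes w))) →
    toℕ j ≡ suc (toℕ i) → R (lookup (nodes w) i) (lookup (nodes w) j)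
  consecutive (here _) zero (suc ()) _
  consecutive (here _) (suc ()) _ _
  consecutive (step _ r _) zero (suc zero) _ = r
  consecutive (step _ _ _) zero (suc (suc _)) ()
  consecutive (step _ _ w) (suc i) (suc j) j≡1+i = consecutive w i j (suc-injective j≡1+i)

  lastNode : ∀ {P x y} (w : Walk R P x y) (j : Fin (length (nodes w))) →
    suc (toℕ j) ≡ length (nodes w) → lookup (nodes w) j ≡ y
  lastNode (here _) zero _ = refl
  lastNode (step _ _ (here _)) zero ()
  lastNode (step _ _ (step _ _ _)) zero ()
  lastNode (step _ _ w) (suc j) last = lastNode w j (suc-injective last)

  lookup-injective : ∀ {xs : List A} → Unique xs → ∀ i j → lookup xs i ≡ lookup xs j → i ≡ j
  lookup-injective (_ ∷ _) zero zero _ = refl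
  lookup-injective (x≢xs ∷ _) zero (suc j) x≡ = ⊥-elim (All.lookup x≢xs (∈-lookup j) x≡)
  lookup-injective (x≢xs ∷ _) (suc i) zero ≡x = ⊥-elim (All.lookup x≢xs (∈-lookup i) (≡.sym ≡x))
  lookup-injective (_ ∷ unique) (suc i) (suc j) eq = ≡.cong suc (lookup-injective unique i j eq)

  closeCycle : ∀ {P x y} (K : A) (w : Walk R P x y) → Unique (nodes w) →
    All (K ≢_) (nodes w) → R K x → R y K →
    IsCycle R (suc (length (nodes w))) (lookup (K ∷ nodes w))
  closeCycle K w unique K∉w Kx yK = injective , around , closing
    where
      injective : ∀ {i j} → lookup (K ∷ nodes w) i ≡ lookup (K ∷ nodes w) j → i ≡ j
      injective {i} {j} = lookup-injective (K∉w ∷ unique) i j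
      around : ∀ i j → toℕ j ≡ suc (toℕ i) → R (lookup (K ∷ nodes w) i) (lookup (K ∷ nodes w) j)
      around zero (suc zero) _ = Kx
      around zero (suc (suc _)) ()
      around (suc i) (suc j) j≡1+i = consecutive w i j (suc-injective j≡1+i)
      closing : ∀ i j → toℕ i ≡ 0 → suc (toℕ j) ≡ suc (length (nodes w)) →
        R (lookup (K ∷ nodes w) j) (lookup (K ∷ nodes w) i)
      closing zero zero _ ()
      closing zero (suc j) _ last = subst (λ N → R N K) (≡.sym (lastNode w j (suc-injective last))) yK

¬¬-∀-Fin : ∀ k {Q : Fin k → Set} → (∀ i → ¬ ¬ Q i) → ¬ ¬ (∀ i → Q i)
¬¬-∀-Fin zero _ k = k λ ()
¬¬-∀-Fin (suc m) ¬¬Q k =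
  ¬¬Q zero λ q₀ → ¬¬-∀-Fin m (λ i → ¬¬Q (suc i)) λ qₛ → k λ { zero → q₀ ; (suc i) → qₛ i }

module GreedyExtension {n} (G : Graph n) (adj? : ∀ x y → Dec (Adj G x y)) where

  Extends : Fin n → Subset n → Set
  Extends x S = ∀ y → y ∈ S → x ≢ y → Adj G x y

  extends? : ∀ x S → Dec (Extends x S)
  extends? x S = all? λ y → y ∈? S →-dec ¬? (x ≟ᶠ y) →-dec adj? x y

  greedy : List (Fin n) → Subset n → Subset n
  greedy [] S = S
  greedy (x ∷ xs) S with extends? x S
  ... | yes _ = greedy xs (S ∪ ⁅ x ⁆)
  ... | no _ = greedy xs S

  greedy-⊇ : ∀ xs S → S ⊆ greedy xs S
  greedy-⊇ [] S y∈S = y∈S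
  greedy-⊇ (x ∷ xs) S y∈S with extends? x S
  ... | yes _ = greedy-⊇ xs (S ∪ ⁅ x ⁆) (p⊆p∪q ⁅ x ⁆ y∈S)
  ... | no _ = greedy-⊇ xs S y∈S

  ∈-∪-⁅⁆ : ∀ {S : Subset n} {x y : Fin n} → y ∈ S ∪ ⁅ x ⁆ → y ∈ S ⊎ y ≡ x
  ∈-∪-⁅⁆ {S} {x} y∈ with x∈p∪q⁻ S ⁅ x ⁆ y∈
  ... | inj₁ y∈S = inj₁ y∈S
  ... | inj₂ y∈x = inj₂ (x∈⁅y⁆⇒x≡y x y∈x)

  addToClique : ∀ {S : Subset n} {x : Fin n} → IsClique G S → Extends x S → IsClique G (S ∪ ⁅ x ⁆)
  addToClique {S} clique ext a b a∈ b∈ a≢b with ∈-∪-⁅⁆ {S} a∈ | ∈-∪-⁅⁆ {S} b∈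
  ... | inj₁ a∈S | inj₁ b∈S = clique a b a∈S b∈S a≢b
  ... | inj₁ a∈S | inj₂ refl = sym G (ext a a∈S λ b≡a → a≢b (≡.sym b≡a))
  ... | inj₂ refl | inj₁ b∈S = ext b b∈S a≢b
  ... | inj₂ refl | inj₂ refl = ⊥-elim (a≢b refl)

  greedy-clique : ∀ xs S → IsClique G S → IsClique G (greedy xs S)
  greedy-clique [] S clique = clique
  greedy-clique (x ∷ xs) S clique with extends? x S
  ... | yes ext = greedy-clique xs (S ∪ ⁅ x ⁆) (addToClique clique ext)
  ... | no _ = greedy-clique xs S clique

  -- A candidate that extends the final clique was added to it: at its turn
  -- it extended the (smaller) clique built so far.
  greedy-saturated : ∀ xs S x → x ∈ˡ xs → Extends x (greedy xs S) → x ∈ greedy xs S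
  greedy-saturated (x′ ∷ xs) S x x∈ ext with extends? x′ S
  greedy-saturated (x′ ∷ xs) S x (here refl) ext | yes _ =
    greedy-⊇ xs (S ∪ ⁅ x ⁆) (x∈p∪q⁺ (inj₂ (x∈⁅x⁆ x)))
  greedy-saturated (x′ ∷ xs) S x (there x∈) ext | yes _ = greedy-saturated xs (S ∪ ⁅ x′ ⁆) x x∈ ext
  greedy-saturated (x′ ∷ xs) S x (here refl) ext | no ¬ext =
    ⊥-elim (¬ext λ y y∈S → ext y (greedy-⊇ xs S y∈S))
  greedy-saturated (x′ ∷ xs) S x (there x∈) ext | no _ = greedy-saturated xs S x x∈ ext

  maximalExtension : ∀ S → IsClique G S → MaxClique G (greedy (allFin n) S)
  maximalExtension S clique = greedy-clique (allFin n) S clique , λ D cliqueD ⊇greedy →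
    ⊆-antisym (λ {x} x∈D → greedy-saturated (allFin n) S x (∈-allFin x)
                 λ y y∈ → cliqueD x y x∈D (⊇greedy y∈))
              ⊇greedy

  edgeClique : ∀ {a b} → Adj G a b → IsClique G (⁅ a ⁆ ∪ ⁅ b ⁆)
  edgeClique {a} {b} ab = addToClique singleton λ y y∈a _ →
    subst (Adj G b) (≡.sym (x∈⁅y⁆⇒x≡y a y∈a)) (sym G ab)
    where
      singleton : IsClique G ⁅ a ⁆
      singleton x y x∈ y∈ x≢y = ⊥-elim (x≢y (≡.trans (x∈⁅y⁆⇒x≡y a x∈) (≡.sym (x∈⁅y⁆⇒x≡y a y∈))))

-- Every edge lies in a maximal clique. Adjacency need not be decidable, so
-- this holds only up to double negation, which suffices to refute adjacency.
edgeInMaxClique : ∀ {n} (G : Graph n) {a b} → Adj G a b →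
  ¬ ¬ (Σ (Subset n) λ C → MaxClique G C × a ∈ C × b ∈ C)
edgeInMaxClique {n} G {a} {b} ab noClique =
  ¬¬-∀-Fin n (λ _ → ¬¬-∀-Fin n λ _ → ¬¬-excluded-middle) λ adj? →
    let open GreedyExtension G adj?
        ab∈ = greedy-⊇ (allFin n) (⁅ a ⁆ ∪ ⁅ b ⁆)
    in noClique (greedy (allFin n) (⁅ a ⁆ ∪ ⁅ b ⁆) , maximalExtension _ (edgeClique ab) ,
                 ab∈ (x∈p∪q⁺ (inj₁ (x∈⁅x⁆ a))) , ab∈ (x∈p∪q⁺ (inj₂ (x∈⁅x⁆ b))))

privateVertex : ∀ {n} {G : Graph n} {X Y} → MaxClique G X → MaxClique G Y → X ≢ Y →
  ∃ λ x → x ∈ X × x ∉ Y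
privateVertex {X = X} {Y} maxX maxY X≢Y with any? (λ x → x ∈? X ×-dec ¬? (x ∈? Y))
... | yes found = found
... | no none = ⊥-elim (X≢Y (≡.sym (proj₂ maxX Y (proj₁ maxY) X⊆Y)))
  where
    X⊆Y : X ⊆ Y
    X⊆Y {x} x∈X = decidable-stable (x ∈? Y) λ x∉Y → none (x , x∈X , x∉Y)

_≟ˢ_ : ∀ {n} → DecidableEquality (Subset n)
_≟ˢ_ = ≡-dec _≟ᵇ_

module CliqueTreeSeparation {n} (G : Graph n) (T : Subset n → Subset n → Set)
                            (ct : IsCliqueTree G T) where
  open IsCliqueTree ct
  open Walks T

  maxˡ : ∀ {X Y} → T X Y → MaxClique G X
  maxˡ t = proj₁ (onMax t)

  maxʳ : ∀ {X Y} → T X Y → MaxClique G Y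
  maxʳ t = proj₂ (onMax t)

  edge⇒≢ : ∀ {X Y} → T X Y → X ≢ Y
  edge⇒≢ t refl = irreflT t

  Avoiding : Subset n → Subset n → Subset n → Set
  Avoiding K X Y = Walk T (_≢ K) X Y

  -- Distinct neighbours P, Q of K are joined only through K: a K-avoiding
  -- walk P ⇝ Q would, after loop erasure, close up to a cycle through K.
  throughCentre : ∀ {K P Q} → T K P → T K Q → P ≢ Q → ¬ Avoiding K P Q
  throughCentre {K} KP KQ P≢Q w with simplify _≟ˢ_ w
  ... | here _ , _ = P≢Q refl
  ... | w′@(step _ _ _) , unique =
    acyclic _ (s≤s (s≤s (s≤s z≤n))) _
      (closeCycle K w′ unique (All.map ≡.≢-sym (allHold w′)) KP (symT KQ))

  edgeCut : ∀ {Y Z C} → T Y Z → Avoiding Z Y C → Avoiding Y C Z → ⊥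
  edgeCut {Y} YZ fromY toZ with afterLastVisit _≟ˢ_ Y fromY (startHolds toZ)
  ... | inj₁ w = proj₂ (startHolds w) refl
  ... | inj₂ (Y′ , YY′ , Y′≢Z , w) = throughCentre YY′ YZ Y′≢Z (mapWalk proj₂ w ++ʷ toZ)

  Apart : Fin n → Fin n → Set
  Apart x y = ∀ C → MaxClique G C → x ∈ C → y ∈ C → ⊥

  apart-sym : ∀ {x y} → Apart x y → Apart y x
  apart-sym apart C maxC y∈C x∈C = apart C maxC x∈C y∈C

  avoid : ∀ {x K X Y} → x ∉ K → Walk T (InM G x) X Y → Avoiding K X Y
  avoid x∉K = mapWalk λ { (_ , x∈N) refl → x∉K x∈N }

  -- If the node K separates X from Y, vertices of X and of Y outside K are
  -- apart: a common clique would join the subtrees T[𝓜_x] and T[𝓜_y].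
  apartAcross : ∀ {K X Y x y} → ¬ Avoiding K X Y → MaxClique G X → MaxClique G Y →
    x ∈ X → x ∉ K → y ∈ Y → y ∉ K → Apart x y
  apartAcross {X = X} {Y} {x} {y} separated maxX maxY x∈X x∉K y∈Y y∉K C maxC x∈C y∈C =
    separated (avoid x∉K (connMv x X C (maxX , x∈X) (maxC , x∈C))
               ++ʷ avoid y∉K (connMv y C Y (maxC , y∈C) (maxY , y∈Y)))

  apartOverEdge : ∀ {Y Z x y} → T Y Z → x ∈ Y → x ∉ Z → y ∈ Z → y ∉ Y → Apart x y
  apartOverEdge {Y} {Z} {x} {y} YZ x∈Y x∉Z y∈Z y∉Y C maxC x∈C y∈C =
    edgeCut YZ (avoid x∉Z (connMv x Y C (maxˡ YZ , x∈Y) (maxC , x∈C)))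
               (avoid y∉Y (connMv y C Z (maxC , y∈C) (maxʳ YZ , y∈Z)))

  apartBranches : ∀ {B Y Z x y} → T B Y → T B Z → Y ≢ Z →
    x ∈ Y → x ∉ B → y ∈ Z → y ∉ B → Apart x y
  apartBranches BY BZ Y≢Z = apartAcross (throughCentre BY BZ Y≢Z) (maxʳ BY) (maxʳ BZ)

  convex : ∀ {B Y Z u} → T B Y → T B Z → Y ≢ Z → u ∈ Y → u ∈ Z → u ∈ B
  convex {B} {Y} {u = u} BY BZ Y≢Z u∈Y u∈Z = decidable-stable (u ∈? B) λ u∉B →
    apartBranches BY BZ Y≢Z u∈Y u∉B u∈Z u∉B Y (maxʳ BY) u∈Y u∈Y

  apartFromBranch : ∀ {B Y Z a z} → T B Y → T B Z → Y ≢ Z →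
    a ∈ Y → a ∉ B → z ∈ Z → z ∉ Y → Apart a z
  apartFromBranch {B} {z = z} BY BZ Y≢Z a∈Y a∉B z∈Z z∉Y with z ∈? B
  ... | yes z∈B = apart-sym (apartOverEdge BY z∈B z∉Y a∈Y a∉B)
  ... | no z∉B = apartBranches BY BZ Y≢Z a∈Y a∉B z∈Z z∉B

  -- Along a path Y – B – Y₂ – Z in T (Z ≠ B), vertices of Z outside Y₂ are
  -- apart from vertices of Y outside B, since Y₂ separates Z from Y.
  apartBeyond : ∀ {B Y Y₂ Z x a} → T B Y → T B Y₂ → Y ≢ Y₂ → T Y₂ Z → Z ≢ B →
    x ∈ Z → x ∉ Y₂ → a ∈ Y → a ∉ B → Apart x a
  apartBeyond {B} {Y} {Y₂} {Z} {a = a} BY BY₂ Y≢Y₂ Y₂Z Z≢B x∈Z x∉Y₂ a∈Y a∉B =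
    apartAcross separated (maxʳ Y₂Z) (maxʳ BY) x∈Z x∉Y₂ a∈Y a∉Y₂
    where
      a∉Y₂ : a ∉ Y₂
      a∉Y₂ a∈Y₂ = a∉B (convex BY BY₂ Y≢Y₂ a∈Y a∈Y₂)
      separated : ¬ Avoiding Y₂ Z Y
      separated w = throughCentre Y₂Z (symT BY₂) Z≢B
        (w ++ʷ step Y≢Y₂ (symT BY) (here (edge⇒≢ BY₂)))

module ClawFreeCliqueTree {n} (G : Graph n) (claw-free : ClawFree G)
                          (T : Subset n → Subset n → Set) (ct : IsCliqueTree G T) where
  open IsCliqueTree ct
  open Walks T
  open CliqueTreeSeparation G T ct

  adjacentIn : ∀ {X x y} → MaxClique G X → x ∈ X → y ∈ X → x ≢ y → Adj G x y
  adjacentIn maxX x∈X y∈X x≢y = proj₁ maxX _ _ x∈X y∈X x≢y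

  ∈∉⇒≢ : ∀ {x y : Fin n} {X : Subset n} → x ∈ X → y ∉ X → x ≢ y
  ∈∉⇒≢ x∈X y∉X refl = y∉X x∈X

  apart⇒¬adj : ∀ {a b} → Apart a b → ¬ Adj G a b
  apart⇒¬adj apart ab = edgeInMaxClique G ab λ (C , maxC , a∈C , b∈C) → apart C maxC a∈C b∈C

  apart⇒≢ : ∀ {u a b} → Adj G u a → Apart a b → a ≢ b
  apart⇒≢ ua apart refl = edgeInMaxClique G ua λ (C , maxC , _ , a∈C) → apart C maxC a∈C a∈C

  noApartTriple : ∀ {u a b c} → Adj G u a → Adj G u b → Adj G u c →
    Apart a b → Apart b c → Apart a c → ⊥
  noApartTriple ua ub uc ab bc ac =
    claw-free _ _ _ _ (apart⇒≢ ua ab) (apart⇒≢ ub bc) (apart⇒≢ ua ac) ua ub uc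
      (apart⇒¬adj ab , apart⇒¬adj bc , apart⇒¬adj ac)

  beyond : ∀ {X Y} → T X Y → ∃ λ y → y ∈ Y × y ∉ X
  beyond XY = privateVertex {G = G} (maxʳ XY) (maxˡ XY) (≡.≢-sym (edge⇒≢ XY))

  record Branches (B Y₁ Y₂ Y₃ : Subset n) : Set where
    constructor branches
    field
      edge₁ : T B Y₁
      edge₂ : T B Y₂
      edge₃ : T B Y₃
      Y₁≢Y₂ : Y₁ ≢ Y₂
      Y₂≢Y₃ : Y₂ ≢ Y₃
      Y₁≢Y₃ : Y₁ ≢ Y₃

  -- No vertex u of B lies in three neighbours of B: the vertices of these
  -- neighbours outside B are pairwise apart neighbours of u.
  noThreeBranches : ∀ {B Y₁ Y₂ Y₃ u} → Branches B Y₁ Y₂ Y₃ →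
    u ∈ B → u ∈ Y₁ → u ∈ Y₂ → u ∈ Y₃ → ⊥
  noThreeBranches (branches BY₁ BY₂ BY₃ Y₁≢Y₂ Y₂≢Y₃ Y₁≢Y₃) u∈B u∈Y₁ u∈Y₂ u∈Y₃ =
    let (a₁ , a₁∈Y₁ , a₁∉B) = beyond BY₁
        (a₂ , a₂∈Y₂ , a₂∉B) = beyond BY₂
        (a₃ , a₃∈Y₃ , a₃∉B) = beyond BY₃
    in noApartTriple
         (adjacentIn (maxʳ BY₁) u∈Y₁ a₁∈Y₁ (∈∉⇒≢ u∈B a₁∉B))
         (adjacentIn (maxʳ BY₂) u∈Y₂ a₂∈Y₂ (∈∉⇒≢ u∈B a₂∉B))
         (adjacentIn (maxʳ BY₃) u∈Y₃ a₃∈Y₃ (∈∉⇒≢ u∈B a₃∉B))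
         (apartBranches BY₁ BY₂ Y₁≢Y₂ a₁∈Y₁ a₁∉B a₂∈Y₂ a₂∉B)
         (apartBranches BY₂ BY₃ Y₂≢Y₃ a₂∈Y₂ a₂∉B a₃∈Y₃ a₃∉B)
         (apartBranches BY₁ BY₃ Y₁≢Y₃ a₁∈Y₁ a₁∉B a₃∈Y₃ a₃∉B)

  -- If two neighbours Y, Y′ of B share a vertex u of B, every vertex x of B
  -- outside Y lies in Y′; otherwise u centres a claw.
  coversRest : ∀ {B Y Y′ u x} → T B Y → T B Y′ → Y ≢ Y′ →
    u ∈ B → u ∈ Y → u ∈ Y′ → x ∈ B → x ∉ Y → x ∈ Y′
  coversRest {Y′ = Y′} {x = x} BY BY′ Y≢Y′ u∈B u∈Y u∈Y′ x∈B x∉Y =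
    decidable-stable (x ∈? Y′) λ x∉Y′ →
      let (a , a∈Y , a∉B) = beyond BY
          (a′ , a′∈Y′ , a′∉B) = beyond BY′
      in noApartTriple
           (adjacentIn (maxʳ BY) u∈Y a∈Y (∈∉⇒≢ u∈B a∉B))
           (adjacentIn (maxʳ BY′) u∈Y′ a′∈Y′ (∈∉⇒≢ u∈B a′∉B))
           (adjacentIn (maxˡ BY) u∈B x∈B (∈∉⇒≢ u∈Y x∉Y))
           (apartBranches BY BY′ Y≢Y′ a∈Y a∉B a′∈Y′ a′∉B)
           (apart-sym (apartOverEdge BY′ x∈B x∉Y′ a′∈Y′ a′∉B))
           (apart-sym (apartOverEdge BY x∈B x∉Y a∈Y a∉B))

  -- Let Y, Y₂ be distinct neighbours of B and Z ≠ B a neighbour of Y₂. If v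
  -- lies in B, Y, Y₂ and Z, then every vertex z of Y₂ outside Z lies in Y;
  -- otherwise v centres a claw.
  squeezed : ∀ {B Y Y₂ Z v z} → T B Y → T B Y₂ → Y ≢ Y₂ → T Y₂ Z → Z ≢ B →
    v ∈ B → v ∈ Y → v ∈ Y₂ → v ∈ Z → z ∈ Y₂ → z ∉ Z → z ∈ Y
  squeezed {Y = Y} {z = z} BY BY₂ Y≢Y₂ Y₂Z Z≢B v∈B v∈Y v∈Y₂ v∈Z z∈Y₂ z∉Z =
    decidable-stable (z ∈? Y) λ z∉Y →
      let (y , y∈Z , y∉Y₂) = beyond Y₂Z
          (a , a∈Y , a∉B) = beyond BY
      in noApartTriple
           (adjacentIn (maxʳ Y₂Z) v∈Z y∈Z (∈∉⇒≢ v∈Y₂ y∉Y₂))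
           (adjacentIn (maxʳ BY) v∈Y a∈Y (∈∉⇒≢ v∈B a∉B))
           (adjacentIn (maxʳ BY₂) v∈Y₂ z∈Y₂ (∈∉⇒≢ v∈Z z∉Z))
           (apartBeyond BY BY₂ Y≢Y₂ Y₂Z Z≢B y∈Z y∉Y₂ a∈Y a∉B)
           (apartFromBranch BY BY₂ Y≢Y₂ a∈Y a∉B z∈Y₂ z∉Y)
           (apart-sym (apartOverEdge Y₂Z z∈Y₂ z∉Z y∈Z y∉Y₂))

  record InPair (B Y Y′ Y″ : Subset n) (u : Fin n) : Set where
    constructor inPair
    field
      atB : u ∈ B
      atY : u ∈ Y
      atY′ : u ∈ Y′
      notY″ : u ∉ Y″

  swapPair : ∀ {B Y Y′ Y″ u} → InPair B Y Y′ Y″ u → InPair B Y′ Y Y″ u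
  swapPair (inPair u∈B u∈Y u∈Y′ u∉Y″) = inPair u∈B u∈Y′ u∈Y u∉Y″

  -- Three neighbours of B, each two of which share a vertex of B lying
  -- outside the third: the configuration of a fork triangle.
  record TriangleWitness (B Y₁ Y₂ Y₃ : Subset n) : Set where
    constructor triangleWitness
    field
      around : Branches B Y₁ Y₂ Y₃
      u₁₂ u₂₃ u₃₁ : Fin n
      in₁₂ : InPair B Y₁ Y₂ Y₃ u₁₂
      in₂₃ : InPair B Y₂ Y₃ Y₁ u₂₃
      in₃₁ : InPair B Y₃ Y₁ Y₂ u₃₁

  rotate : ∀ {B Y₁ Y₂ Y₃} → TriangleWitness B Y₁ Y₂ Y₃ → TriangleWitness B Y₂ Y₃ Y₁
  rotate (triangleWitness (branches BY₁ BY₂ BY₃ Y₁≢Y₂ Y₂≢Y₃ Y₁≢Y₃) u₁₂ u₂₃ u₃₁ in₁₂ in₂₃ in₃₁) =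
    triangleWitness (branches BY₂ BY₃ BY₁ Y₂≢Y₃ (≡.≢-sym Y₁≢Y₃) (≡.≢-sym Y₁≢Y₂))
      u₂₃ u₃₁ u₁₂ in₂₃ in₃₁ in₁₂

  mirror : ∀ {B Y₁ Y₂ Y₃} → TriangleWitness B Y₁ Y₂ Y₃ → TriangleWitness B Y₂ Y₁ Y₃
  mirror (triangleWitness (branches BY₁ BY₂ BY₃ Y₁≢Y₂ Y₂≢Y₃ Y₁≢Y₃) u₁₂ u₂₃ u₃₁ in₁₂ in₂₃ in₃₁) =
    triangleWitness (branches BY₂ BY₁ BY₃ (≡.≢-sym Y₁≢Y₂) Y₁≢Y₃ Y₂≢Y₃)
      u₁₂ u₃₁ u₂₃ (swapPair in₁₂) (swapPair in₃₁) (swapPair in₂₃)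

  -- u₁₂ lies in no neighbour Z ≠ B of Y₂. Otherwise u₂₃ ∈ Z as well, and a
  -- vertex r ∈ Y₂ ∖ Z would lie in Y₁ and in Y₃ (by squeezing at u₁₂ and
  -- u₂₃) and hence in B, contradicting noThreeBranches.
  noEscape : ∀ {B Y₁ Y₂ Y₃ Z} (tw : TriangleWitness B Y₁ Y₂ Y₃) → T Y₂ Z → Z ≢ B →
    TriangleWitness.u₁₂ tw ∉ Z
  noEscape {Y₁ = Y₁} {Y₂} {Y₃} {Z}
    (triangleWitness br@(branches BY₁ BY₂ BY₃ Y₁≢Y₂ Y₂≢Y₃ _) u s _
                     (inPair u∈B u∈Y₁ u∈Y₂ _) (inPair s∈B s∈Y₂ s∈Y₃ s∉Y₁) _) Y₂Z Z≢B u∈Z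
    with beyond (symT Y₂Z)
  ... | r , r∈Y₂ , r∉Z = noThreeBranches br (convex BY₁ BY₂ Y₁≢Y₂ r∈Y₁ r∈Y₂) r∈Y₁ r∈Y₂ r∈Y₃
    where
      s∈Z : s ∈ Z
      s∈Z = decidable-stable (s ∈? Z) λ s∉Z →
        s∉Y₁ (squeezed BY₁ BY₂ Y₁≢Y₂ Y₂Z Z≢B u∈B u∈Y₁ u∈Y₂ u∈Z s∈Y₂ s∉Z)
      r∈Y₁ : r ∈ Y₁
      r∈Y₁ = squeezed BY₁ BY₂ Y₁≢Y₂ Y₂Z Z≢B u∈B u∈Y₁ u∈Y₂ u∈Z r∈Y₂ r∉Z
      r∈Y₃ : r ∈ Y₃
      r∈Y₃ = squeezed BY₃ BY₂ (≡.≢-sym Y₂≢Y₃) Y₂Z Z≢B s∈B s∈Y₃ s∈Y₂ s∈Z r∈Y₂ r∉Z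

  OneOf : Subset n → Subset n → Subset n → Subset n → Set
  OneOf X B Y C = C ≡ X ⊎ C ≡ B ⊎ C ≡ Y

  oneOf? : ∀ X B Y C → Dec (OneOf X B Y C)
  oneOf? X B Y C = C ≟ˢ X ⊎-dec C ≟ˢ B ⊎-dec C ≟ˢ Y

  -- The maximal cliques containing u₁₂ are exactly Y₁, B and Y₂: since
  -- T[𝓜_u₁₂] is connected, any further one yields a tree edge leaving
  -- {Y₁, B, Y₂} into a clique containing u₁₂, which noEscape (at Y₁ or Y₂)
  -- and noThreeBranches (at B) rule out.
  cliquesOf : ∀ {B Y₁ Y₂ Y₃} (tw : TriangleWitness B Y₁ Y₂ Y₃) →
    MuIs G (TriangleWitness.u₁₂ tw) Y₁ B Y₂
  cliquesOf {B} {Y₁} {Y₂} tw@(triangleWitness (branches BY₁ BY₂ _ Y₁≢Y₂ _ _) u _ _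
                               (inPair u∈B u∈Y₁ u∈Y₂ _) _ _) C maxC = onlyThese , these
    where
      these : OneOf Y₁ B Y₂ C → u ∈ C
      these (inj₁ refl) = u∈Y₁
      these (inj₂ (inj₁ refl)) = u∈B
      these (inj₂ (inj₂ refl)) = u∈Y₂
      noExit : ∀ {X Z} → OneOf Y₁ B Y₂ X → ¬ OneOf Y₁ B Y₂ Z → T X Z → u ∉ Z
      noExit (inj₁ refl) Z∉ Y₁Z = noEscape (mirror tw) Y₁Z λ Z≡B → Z∉ (inj₂ (inj₁ Z≡B))
      noExit (inj₂ (inj₁ refl)) Z∉ BZ u∈Z =
        noThreeBranches (branches BY₁ BY₂ BZ Y₁≢Y₂ (λ Y₂≡Z → Z∉ (inj₂ (inj₂ (≡.sym Y₂≡Z))))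
                                  (λ Y₁≡Z → Z∉ (inj₁ (≡.sym Y₁≡Z))))
                        u∈B u∈Y₁ u∈Y₂ u∈Z
      noExit (inj₂ (inj₂ refl)) Z∉ Y₂Z = noEscape tw Y₂Z λ Z≡B → Z∉ (inj₂ (inj₁ Z≡B))
      onlyThese : u ∈ C → OneOf Y₁ B Y₂ C
      onlyThese u∈C = decidable-stable (oneOf? Y₁ B Y₂ C) λ C∉ →
        let (_ , _ , X∈ , Z∉ , XZ , (_ , u∈Z)) =
              exitEdge (OneOf Y₁ B Y₂) (oneOf? Y₁ B Y₂)
                       (connMv u B C (maxˡ BY₁ , u∈B) (maxC , u∈C)) (inj₂ (inj₁ refl)) C∉
        in noExit X∈ Z∉ XZ u∈Z

  forkTriangle : ∀ {B Y₁ Y₂ Y₃} → TriangleWitness B Y₁ Y₂ Y₃ → HasForkTriangle G T B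
  forkTriangle tw@(triangleWitness (branches BY₁ BY₂ BY₃ Y₁≢Y₂ Y₂≢Y₃ Y₁≢Y₃) u₁₂ u₂₃ u₃₁ _ _ _) =
    _ , _ , _ , maxʳ BY₁ , maxʳ BY₂ , maxʳ BY₃ , Y₁≢Y₂ , Y₂≢Y₃ , Y₁≢Y₃ , BY₁ , BY₂ , BY₃ ,
    (u₁₂ , cliquesOf tw) , (u₂₃ , cliquesOf (rotate tw)) , (u₃₁ , cliquesOf (rotate (rotate tw)))

  -- A fork (A′, B, {A_P, A_Q}) of T[𝓜_w] and T[𝓜_v] gives a triangle witness
  -- on A′, A_P, A_Q: w and v, together with any x ∈ B ∖ A′, which lies in
  -- A_P and in A_Q by coversRest (at w and at v respectively).
  witnessOfFork : ∀ {v w B} → ForkIn G T w v B →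
    Σ (Subset n) λ Y₁ → Σ (Subset n) λ Y₂ → Σ (Subset n) λ Y₃ → TriangleWitness B Y₁ Y₂ Y₃
  witnessOfFork {v} {w} (A′ , AP , AQ ,
      ((_ , w∈A′) , (_ , w∈B) , (maxP , w∈AP) , _ , _ , A′≢AP , A′B , BAP , _) ,
      ((_ , v∈A′) , (_ , v∈B) , (maxQ , v∈AQ) , _ , _ , A′≢AQ , _ , BAQ , _) ,
      v∉AP , w∉AQ) with beyond A′B
  ... | x , x∈B , x∉A′ =
    A′ , AP , AQ ,
    triangleWitness (branches (symT A′B) BAP BAQ A′≢AP AP≢AQ A′≢AQ) w x v
      (inPair w∈B w∈A′ w∈AP λ w∈AQ → w∉AQ (maxQ , w∈AQ))
      (inPair x∈B x∈AP x∈AQ x∉A′)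
      (inPair v∈B v∈AQ v∈A′ λ v∈AP → v∉AP (maxP , v∈AP))
    where
      AP≢AQ : AP ≢ AQ
      AP≢AQ refl = w∉AQ (maxP , w∈AP)
      x∈AP : x ∈ AP
      x∈AP = coversRest (symT A′B) BAP A′≢AP w∈B w∈A′ w∈AP x∈B x∉A′
      x∈AQ : x ∈ AQ
      x∈AQ = coversRest (symT A′B) BAQ A′≢AQ v∈B v∈A′ v∈AQ x∈B x∉A′

-- Connectedness and chordality are what make T the (unique) clique tree of
-- G; given T, the argument only uses claw-freeness.
lemma3p10 : ∀ {n} (G : Graph n) → Connected G → Chordal G → ClawFree G →
            (T : Subset n → Subset n → Set) → IsCliqueTree G T →
            (v w : Fin n) (B : Subset n) → MaxClique G B →
            ForkIn G T w v B → HasForkTriangle G T B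
lemma3p10 G _ _ claw-free T ct v w B _ fork =
  forkTriangle (proj₂ (proj₂ (proj₂ (witnessOfFork fork))))
  where open ClawFreeCliqueTree G claw-free T ct
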